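{- The algorithm $\mathsf{ON}$ (described in the context) satisfies the capacity constraint: the total weight $\sum w(\ell)$ of the left vertices (items) matched in $\mathsf{M}_{\mathsf{ON}}$ is at most $C$.
   Context: Items $i$, $|\mathcal{I}|=n$, have value $v(i)>0$, weight $w(i)\le C$ ($C$ the capacity), and buck per bang $b(i)=w(i)/v(i)$; they arrive online in some order and must be accepted/rejected irrevocably on arrival. Model: bipartite graph $G=(L\cup R,E)$, $|L|=|R|=n$, left vertices are the items, every pair $(\ell,r)$ is an edge with value $v(e)=v(\ell)$ and buck per bang $b(e)=w(\ell)/v(e)$. $G(\gamma)$ is $G$ with edges of $b(e)>\gamma$ removed; $\textsc{Greedy}(H)$ scans edges in decreasing value and adds each edge that keeps a matching; $v(\mathsf{M})=\sum_{e\in\mathsf{M}}v(e)$. \textsc{Threshold}$(H,C)$ outputs $\gamma_C(H)=\max\{\gamma:\sum_{e\in\mathsf{M}}\gamma v(e)\le C,\ \mathsf{M}=\textsc{Greedy}(H(\gamma))\}$ and the matching $\textsc{Greedy}(H(\gamma_C(H)))$. Algorithm $\mathsf{ON}$ with parameter $t$: do not accept the first $t$ arriving left vertices; run \textsc{Threshold} on the graph $G_t$ formed by them and $R$ with capacity $C$, obtaining $\gamma_t$ and $\mathsf{M}_t$. For $r\in R$ with $(\ell,r)\in\mathsf{M}_t$ set $\mathrm{price}(r)=b(\ell)$, $\mathrm{cost}(r)=w(\ell)$, otherwise $\mathrm{price}(r)=\mathrm{cost}(r)=0$; let $R'=\{r:\mathrm{price}(r)>0\}$, $\mathsf{M}_{\mathsf{ON}}=\emptyset$.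 For each later arriving $\ell$: if $b(\ell)>\gamma_t$ reject $\ell$; else let $e^\star=(\ell,r)$ be the edge with smallest $\mathrm{price}(r)$, $r\in R'$, with $b(\ell)<\mathrm{price}(r)$ and $w(\ell)<\mathrm{cost}(r)$, and add $e^\star$ to $\mathsf{M}_{\mathsf{ON}}$ if $\mathsf{M}_{\mathsf{ON}}\cup\{e^\star\}$ is a matching, otherwise reject $\ell$. -}

module Defs where

open import Data.Nat using (ℕ)
open import Data.Fin using (Fin; _≟_)
open import Data.Rational using (ℚ; 0ℚ; _+_; _*_; _÷_; _≤_; _<_; _≤?_; >-nonZero)
open import Data.Product using (Σ; _×_; _,_; proj₁; proj₂)
open import Data.Sum using (_⊎_)
open import Data.List using (List; []; _∷_; filter; cartesianProduct; allFin; foldr; map)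
open import Data.List.Relation.Unary.Any using (Any)
open import Data.List.Relation.Unary.Linked using (Linked)
open import Data.List.Relation.Binary.Permutation.Propositional using (_↭_)
open import Data.List.Relation.Unary.Any using (any?)
open import Relation.Nullary using (¬_; Dec; yes; no)
open import Relation.Nullary.Decidable using (_⊎-dec_)
open import Relation.Binary.PropositionalEquality using (_≡_)

sumℚ : List ℚ → ℚ
sumℚ = foldr _+_ 0ℚ

-- An instance with n items: capacity C, values v (positive), weights w.
-- Left vertices L = Fin n are the items, right vertices R = Fin n.
-- An edge (ℓ , r) joins item ℓ ∈ L to r ∈ R; every pair is an edge.
module Knapsack (n : ℕ) (C : ℚ) (v w : Fin n → ℚ) (v-pos : ∀ i → 0ℚ < v i) where

  Edge : Set
  Edge = Fin n × Fin n

  b : Fin n → ℚ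
  b i = _÷_ (w i) (v i) {{>-nonZero (v-pos i)}}

  vE : Edge → ℚ
  vE e = v (proj₁ e)

  bE : Edge → ℚ
  bE e = b (proj₁ e)

  allR : List (Fin n)
  allR = allFin n

  -- Edge set of H(γ), where H is the complete bipartite graph between the
  -- left vertices listed in Ls and all of R: edges with b(e) > γ removed.
  edgesBelow : List (Fin n) → ℚ → List Edge
  edgesBelow Ls γ = filter (λ e → bE e ≤? γ) (cartesianProduct Ls allR)

  -- Adding e to M would not keep a matching: an endpoint of e is already covered.
  Conflict : List Edge → Edge → Set
  Conflict M e = Any (λ e' → (proj₁ e' ≡ proj₁ e) ⊎ (proj₂ e' ≡ proj₂ e)) M

  conflict? : (M : List Edge) (e : Edge) → Dec (Conflict M e)
  conflict? M e = any? (λ e' → (proj₁ e' ≟ proj₁ e) ⊎-dec (proj₂ e' ≟ proj₂ e)) M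

  greedyScan : List Edge → List Edge → List Edge
  greedyScan acc [] = acc
  greedyScan acc (e ∷ es) with conflict? acc e
  ... | yes _ = greedyScan acc es
  ... | no  _ = greedyScan (e ∷ acc) es

  -- M is an output of Greedy on the edge set Es: scan Es in decreasing
  -- order of value (ties broken arbitrarily) and add each edge that keeps
  -- a matching.
  IsGreedy : List Edge → List Edge → Set
  IsGreedy Es M =
    Σ (List Edge) λ es →
      (es ↭ Es) × Linked (λ e e' → vE e' ≤ vE e) es × (M ≡ greedyScan [] es)

  Feasible : List (Fin n) → ℚ → Set
  Feasible Ls γ = ∀ M → IsGreedy (edgesBelow Ls γ) M → sumℚ (map (λ e → γ * vE e) M) ≤ C

  -- Threshold(H, C) outputs γ = γ_C(H) (the maximum feasible γ) and
  -- the matching M = Greedy(H(γ)).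
  IsThreshold : List (Fin n) → ℚ → List Edge → Set
  IsThreshold Ls γ M =
    Feasible Ls γ × (∀ γ' → Feasible Ls γ' → γ' ≤ γ) × IsGreedy (edgesBelow Ls γ) M

  priceOf : List Edge → Fin n → ℚ
  priceOf [] r = 0ℚ
  priceOf (e ∷ M) r with proj₂ e ≟ r
  ... | yes _ = b (proj₁ e)
  ... | no  _ = priceOf M r

  costOf : List Edge → Fin n → ℚ
  costOf [] r = 0ℚ
  costOf (e ∷ M) r with proj₂ e ≟ r
  ... | yes _ = w (proj₁ e)
  ... | no  _ = costOf M r

  -- r ∈ R' and the edge (ℓ , r) is admissible for the arriving ℓ.
  Candidate : List Edge → Fin n → Fin n → Set
  Candidate Mt ℓ r =
    (0ℚ < priceOf Mt r) × (b ℓ < priceOf Mt r) × (w ℓ < costOf Mt r)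

  -- Run of the online phase of ON with threshold γ and sample matching Mt:
  -- OnRun γ Mt ls M M' : processing the arriving left vertices ls in order,
  -- starting with current matching M, ends with matching M'.
  -- (Ties in the choice of the smallest price are broken arbitrarily.)
  data OnRun (γ : ℚ) (Mt : List Edge) : List (Fin n) → List Edge → List Edge → Set where
    done : ∀ {M} → OnRun γ Mt [] M M
    reject-b : ∀ {ℓ ls M M'} → γ < b ℓ → OnRun γ Mt ls M M' → OnRun γ Mt (ℓ ∷ ls) M M'
    reject-none : ∀ {ℓ ls M M'} → b ℓ ≤ γ → (∀ r → ¬ Candidate Mt ℓ r) →
      OnRun γ Mt ls M M' → OnRun γ Mt (ℓ ∷ ls) M M'
    accept : ∀ {ℓ r ls M M'} → b ℓ ≤ γ → Candidate Mt ℓ r →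
      (∀ r' → Candidate Mt ℓ r' → priceOf Mt r ≤ priceOf Mt r') →
      ¬ Conflict M (ℓ , r) →
      OnRun γ Mt ls ((ℓ , r) ∷ M) M' → OnRun γ Mt (ℓ ∷ ls) M M'
    reject-conflict : ∀ {ℓ r ls M M'} → b ℓ ≤ γ → Candidate Mt ℓ r →
      (∀ r' → Candidate Mt ℓ r' → priceOf Mt r ≤ priceOf Mt r') →
      Conflict M (ℓ , r) →
      OnRun γ Mt ls M M' → OnRun γ Mt (ℓ ∷ ls) M M'

  weightOf : List Edge → ℚ
  weightOf M = sumℚ (map (λ e → w (proj₁ e)) M)

module Submission where

-- Every accepted item ℓ is matched to some r ∈ R' with w(ℓ) < cost(r), and the
-- matching property makes these r distinct; so the accepted weight is at most
-- the total weight of the sample matching M_t. Each edge of M_t has b ≤ γ_t,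
-- i.e. w ≤ γ_t v, and γ_t is feasible, so that weight is at most C.

open import Defs
open import Data.Nat using (ℕ)
open import Data.Fin using (Fin; _≟_)
open import Data.Rational using (ℚ; 0ℚ; _≤_; _<_; _≤?_; _+_; _*_; _÷_; 1/_; 1ℚ; >-nonZero; nonNegative)
open import Data.Rational.Properties
  using (≤-refl; ≤-trans; <⇒≤; +-mono-≤; +-identityˡ; +-assoc; +-comm; *-assoc; *-inverseˡ; *-identityʳ; *-monoʳ-≤-nonNeg)
open import Data.List using (List; []; _∷_; take; drop; allFin; map; cartesianProduct)
open import Data.List.Relation.Binary.Permutation.Propositional using (_↭_; ↭-sym)
open import Data.List.Relation.Binary.Permutation.Propositional.Properties using (All-resp-↭)
open import Data.List.Relation.Unary.All as All using (All; []; _∷_)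
open import Data.List.Relation.Unary.All.Properties using (all-filter)
open import Data.List.Relation.Unary.All.Properties.Core using (¬Any⇒All¬)
open import Data.Product using (_×_; _,_; proj₁; proj₂)
open import Data.Sum using (inj₂)
open import Function using (_∘_)
open import Relation.Nullary using (yes; no; contradiction)
open import Relation.Binary.PropositionalEquality using (_≡_; _≢_; refl; sym; trans; cong; subst)
open Relation.Binary.PropositionalEquality.≡-Reasoning

sumℚ-map-nonNeg : {A : Set} {f : A → ℚ} → (∀ x → 0ℚ ≤ f x) → ∀ xs → 0ℚ ≤ sumℚ (map f xs)
sumℚ-map-nonNeg f-nonNeg []       = ≤-refl
sumℚ-map-nonNeg {f = f} f-nonNeg (x ∷ xs) =
  subst (_≤ f x + sumℚ (map f xs)) (+-identityˡ 0ℚ) (+-mono-≤ (f-nonNeg x) (sumℚ-map-nonNeg f-nonNeg xs))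

sumℚ-map-mono : {A : Set} {f g : A → ℚ} {xs : List A} →
  All (λ x → f x ≤ g x) xs → sumℚ (map f xs) ≤ sumℚ (map g xs)
sumℚ-map-mono []       = ≤-refl
sumℚ-map-mono (p ∷ ps) = +-mono-≤ p (sumℚ-map-mono ps)

÷-≤⇒≤* : ∀ {p q γ} (0<q : 0ℚ < q) → _÷_ p q {{>-nonZero 0<q}} ≤ γ → p ≤ γ * q
÷-≤⇒≤* {p} {q} {γ} 0<q p/q≤γ =
  subst (_≤ γ * q) p/q*q≡p (*-monoʳ-≤-nonNeg q {{nonNegative (<⇒≤ 0<q)}} p/q≤γ)
  where
  instance _ = >-nonZero 0<q
  p/q*q≡p : (p ÷ q) * q ≡ p
  p/q*q≡p = begin
    p * 1/ q * q   ≡⟨ *-assoc p (1/ q) q ⟩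
    p * (1/ q * q) ≡⟨ cong (p *_) (*-inverseˡ q) ⟩
    p * 1ℚ         ≡⟨ *-identityʳ p ⟩
    p              ∎

module _ (n : ℕ) (C : ℚ) (v w : Fin n → ℚ) (v-pos : ∀ i → 0ℚ < v i) where
  open Knapsack n C v w v-pos

  greedyScan-preserves-All : ∀ {P : Edge → Set} {acc} es →
    All P acc → All P es → All P (greedyScan acc es)
  greedyScan-preserves-All []                   Pacc _          = Pacc
  greedyScan-preserves-All {acc = acc} (e ∷ es) Pacc (Pe ∷ Pes) with conflict? acc e
  ... | yes _ = greedyScan-preserves-All es Pacc Pes
  ... | no  _ = greedyScan-preserves-All es (Pe ∷ Pacc) Pes

  threshold-bE-≤ : ∀ {Ls γ M} → IsThreshold Ls γ M → All (λ e → bE e ≤ γ) M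
  threshold-bE-≤ {Ls} {γ} (_ , _ , es , es↭ , _ , refl) =
    greedyScan-preserves-All es []
      (All-resp-↭ (↭-sym es↭) (all-filter (λ e → bE e ≤? γ) (cartesianProduct Ls allR)))

  weightOf-threshold-≤ : ∀ {Ls γ M} → IsThreshold Ls γ M → weightOf M ≤ C
  weightOf-threshold-≤ {Ls} {M = M} th@(feasible , _ , greedy) =
    ≤-trans (sumℚ-map-mono (All.map (÷-≤⇒≤* (v-pos _)) (threshold-bE-≤ {Ls} th)))
            (feasible M greedy)

  removeTarget : List Edge → Fin n → List Edge
  removeTarget []      r = []
  removeTarget (e ∷ M) r with proj₂ e ≟ r
  ... | yes _ = M
  ... | no  _ = e ∷ removeTarget M r

  weightOf-removeTarget : ∀ M r → weightOf M ≡ costOf M r + weightOf (removeTarget M r)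
  weightOf-removeTarget []             r = sym (+-identityˡ 0ℚ)
  weightOf-removeTarget ((ℓ , r′) ∷ M) r with r′ ≟ r
  ... | yes _ = refl
  ... | no  _ = begin
    w ℓ + weightOf M                  ≡⟨ cong (w ℓ +_) (weightOf-removeTarget M r) ⟩
    w ℓ + (costOf M r + weightOf M∖r) ≡⟨ sym (+-assoc (w ℓ) _ _) ⟩
    w ℓ + costOf M r + weightOf M∖r   ≡⟨ cong (_+ weightOf M∖r) (+-comm (w ℓ) (costOf M r)) ⟩
    costOf M r + w ℓ + weightOf M∖r   ≡⟨ +-assoc (costOf M r) _ _ ⟩
    costOf M r + (w ℓ + weightOf M∖r) ∎
    where M∖r = removeTarget M r

  costOf-removeTarget : ∀ M {r r′} → r′ ≢ r → costOf (removeTarget M r) r′ ≡ costOf M r′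
  costOf-removeTarget []            r′≢r = refl
  costOf-removeTarget ((_ , s) ∷ M) {r} {r′} r′≢r with s ≟ r
  ... | yes s≡r with s ≟ r′
  ...   | yes s≡r′ = contradiction (trans (sym s≡r′) s≡r) r′≢r
  ...   | no  _    = refl
  costOf-removeTarget ((_ , s) ∷ M) {r} {r′} r′≢r | no _ with s ≟ r′
  ...   | yes _ = refl
  ...   | no  _ = costOf-removeTarget M r′≢r

  -- costOf Mt r is the weight of the first edge of Mt at r, which is exactly the
  -- edge removeTarget deletes; so Mt need not be a matching for the charging.
  data ChargedTo (Mt : List Edge) : List Edge → Set where
    []  : ChargedTo Mt []
    _∷_ : ∀ {ℓ r M} → w ℓ ≤ costOf Mt r × All (λ e → proj₂ e ≢ r) M →
          ChargedTo Mt M → ChargedTo Mt ((ℓ , r) ∷ M)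

  ChargedTo-removeTarget : ∀ {Mt r M} → All (λ e → proj₂ e ≢ r) M →
    ChargedTo Mt M → ChargedTo (removeTarget Mt r) M
  ChargedTo-removeTarget [] [] = []
  ChargedTo-removeTarget {Mt} (r′≢r ∷ ≢r) ((w≤cost , fresh) ∷ charged) =
    (subst (_ ≤_) (sym (costOf-removeTarget Mt r′≢r)) w≤cost , fresh)
      ∷ ChargedTo-removeTarget ≢r charged

  weightOf-ChargedTo-≤ : (∀ i → 0ℚ ≤ w i) → ∀ {Mt M} →
    ChargedTo Mt M → weightOf M ≤ weightOf Mt
  weightOf-ChargedTo-≤ w-nonNeg {Mt} [] = sumℚ-map-nonNeg (w-nonNeg ∘ proj₁) Mt
  weightOf-ChargedTo-≤ w-nonNeg {Mt} {(ℓ , r) ∷ M} ((w≤cost , fresh) ∷ charged) =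
    subst (w ℓ + weightOf M ≤_) (sym (weightOf-removeTarget Mt r))
      (+-mono-≤ w≤cost (weightOf-ChargedTo-≤ w-nonNeg (ChargedTo-removeTarget fresh charged)))

  OnRun-preserves-ChargedTo : ∀ {γ Mt ls M M′} → OnRun γ Mt ls M M′ →
    ChargedTo Mt M → ChargedTo Mt M′
  OnRun-preserves-ChargedTo done                          c = c
  OnRun-preserves-ChargedTo (reject-b _ run)              c = OnRun-preserves-ChargedTo run c
  OnRun-preserves-ChargedTo (reject-none _ _ run)         c = OnRun-preserves-ChargedTo run c
  OnRun-preserves-ChargedTo (reject-conflict _ _ _ _ run) c = OnRun-preserves-ChargedTo run c
  OnRun-preserves-ChargedTo (accept _ (_ , _ , w<cost) _ no-conflict run) c =
    OnRun-preserves-ChargedTo run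
      ((<⇒≤ w<cost , All.map (_∘ inj₂) (¬Any⇒All¬ _ no-conflict)) ∷ c)

lemma5 : (n : ℕ) (C : ℚ) (v w : Fin n → ℚ) (v-pos : ∀ i → 0ℚ < v i) →
    (∀ i → w i ≤ C) → (∀ i → 0ℚ ≤ w i) → 0ℚ ≤ C →
    (t : ℕ) (order : List (Fin n)) → order ↭ allFin n →
    (γt : ℚ) (Mt : List (Knapsack.Edge n C v w v-pos)) →
    Knapsack.IsThreshold n C v w v-pos (take t order) γt Mt →
    (Mon : List (Knapsack.Edge n C v w v-pos)) →
    Knapsack.OnRun n C v w v-pos γt Mt (drop t order) [] Mon →
    Knapsack.weightOf n C v w v-pos Mon ≤ C
lemma5 n C v w v-pos _ w-nonNeg _ t order _ _ _ threshold _ run =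
  ≤-trans (weightOf-ChargedTo-≤ n C v w v-pos w-nonNeg (OnRun-preserves-ChargedTo n C v w v-pos run []))
          (weightOf-threshold-≤ n C v w v-pos {take t order} threshold)
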